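{- The function $f$ on integers defined by $f(x)=\min\{2^k\cdot\max\{x,1\}: k\geq 1,\ 2^k\geq x\}$ can be computed by a register machine with two registers in time linear in the number of binary digits of $x$, and $f$ is not automatic.
   Context: Model (addition machine): finitely many registers holding arbitrary integers; unit-cost commands $x=y+z$, $x=y+c$, $x=y-z$, $x=y-c$, $x=c-y$, $x=c$ (registers $x,y,z$, integer constants $c$), read/write of a whole integer, conditionals comparing a register with a register or a constant via $<,=,>,\neq,\leq,\geq$, and goto. Running time is the number of executed commands. A function $f$ on numbers is automatic if there are bases $i,j\geq 2$ and a deterministic finite automaton which reads the base-$i$ representation of $x$ and the base-$j$ representation of a candidate $y$ in parallel symbol by symbol (padded with leading zeros, aligned at the least significant digit) and accepts exactly when $y=f(x)$. -}

module Defs where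

open import Data.Nat as ℕ using (ℕ; zero; suc; _⊔_; _≤_; _*_; _^_)
open import Data.Nat.DivMod using (_/_; _%_; m%n<n)
open import Data.Integer as ℤ using (ℤ; +_; ∣_∣)
open import Data.Fin as Fin using (Fin; fromℕ<)
open import Data.Bool using (Bool; true; false; if_then_else_)
open import Data.List using (List; []; _∷_; _++_; length)
open import Data.Vec using (Vec; []; _∷_; foldl)
open import Data.Maybe using (Maybe; just; nothing)
open import Data.Product using (Σ; _×_; _,_; ∃)
open import Relation.Nullary using (does)
open import Relation.Binary.PropositionalEquality using (_≡_)

data Operand (r : ℕ) : Set where
  reg   : Fin r → Operand r
  const : ℤ → Operand r

data Rel : Set where
  lt eq gt ne le ge : Rel

data Instr (r : ℕ) : Set where
  addRR  : (x y z : Fin r) → Instr r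
  addRC  : (x y : Fin r) → ℤ → Instr r
  subRR  : (x y z : Fin r) → Instr r
  subRC  : (x y : Fin r) → ℤ → Instr r
  subCR  : (x : Fin r) → ℤ → Fin r → Instr r
  setC   : (x : Fin r) → ℤ → Instr r
  read   : Fin r → Instr r
  write  : Fin r → Instr r
  ifGoto : Rel → Fin r → Operand r → ℕ → Instr r
  goto   : ℕ → Instr r

Program : ℕ → Set
Program r = List (Instr r)

record Config (r : ℕ) : Set where
  constructor config
  field
    pc   : ℕ
    regs : Fin r → ℤ
    inp  : List ℤ
    out  : List ℤ
open Config public

nth : {A : Set} → List A → ℕ → Maybe A
nth []       _       = nothing
nth (a ∷ as) zero    = just a
nth (a ∷ as) (suc n) = nth as n

_[_≔_] : {r : ℕ} → (Fin r → ℤ) → Fin r → ℤ → (Fin r → ℤ)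
(ρ [ x ≔ v ]) k = if does (k Fin.≟ x) then v else ρ k

evalOp : {r : ℕ} → (Fin r → ℤ) → Operand r → ℤ
evalOp ρ (reg y)   = ρ y
evalOp ρ (const c) = c

evalRel : Rel → ℤ → ℤ → Bool
evalRel lt a b = does (a ℤ.<? b)
evalRel eq a b = does (a ℤ.≟ b)
evalRel gt a b = does (b ℤ.<? a)
evalRel ne a b = if does (a ℤ.≟ b) then false else true
evalRel le a b = does (a ℤ.≤? b)
evalRel ge a b = does (b ℤ.≤? a)

exec : {r : ℕ} → Instr r → Config r → Maybe (Config r)
exec (addRR x y z) (config p ρ i o) = just (config (suc p) (ρ [ x ≔ ρ y ℤ.+ ρ z ]) i o)
exec (addRC x y c) (config p ρ i o) = just (config (suc p) (ρ [ x ≔ ρ y ℤ.+ c ]) i o)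
exec (subRR x y z) (config p ρ i o) = just (config (suc p) (ρ [ x ≔ ρ y ℤ.- ρ z ]) i o)
exec (subRC x y c) (config p ρ i o) = just (config (suc p) (ρ [ x ≔ ρ y ℤ.- c ]) i o)
exec (subCR x c y) (config p ρ i o) = just (config (suc p) (ρ [ x ≔ c ℤ.- ρ y ]) i o)
exec (setC x c)    (config p ρ i o) = just (config (suc p) (ρ [ x ≔ c ]) i o)
exec (read x)      (config p ρ [] o) = nothing
exec (read x)      (config p ρ (v ∷ i) o) = just (config (suc p) (ρ [ x ≔ v ]) i o)
exec (write x)     (config p ρ i o) = just (config (suc p) ρ i (o ++ (ρ x ∷ [])))
exec (ifGoto R x a l) (config p ρ i o) =
  just (config (if evalRel R (ρ x) (evalOp ρ a) then l else suc p) ρ i o)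
exec (goto l)      (config p ρ i o) = just (config l ρ i o)

-- one step; nothing if halted (pc outside the program) or stuck
step : {r : ℕ} → Program r → Config r → Maybe (Config r)
step P c with nth P (pc c)
... | nothing = nothing
... | just ins = exec ins c

run : {r : ℕ} → ℕ → Program r → Config r → Maybe (Config r)
run zero    P c = just c
run (suc t) P c with step P c
... | nothing = nothing
... | just c' = run t P c'

Halted : {r : ℕ} → Program r → Config r → Set
Halted P c = length P ≤ pc c

initConfig : (r : ℕ) → ℤ → Config r
initConfig r x = config 0 (λ _ → + 0) (x ∷ []) []

ComputesInTime : {r : ℕ} → Program r → (ℤ → ℤ) → (ℤ → ℕ) → Set
ComputesInTime P F T =
  ∀ x → Σ ℕ λ t → t ≤ T x × Σ (Config _) λ c →
    run t P (initConfig _ x) ≡ just c × Halted P c × out c ≡ F x ∷ []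

-- number of base-(2+k) digits of x (0 has 0 digits); fuel argument ≥ x
lenAux : ℕ → ℕ → ℕ → ℕ
lenAux k zero       x       = 0
lenAux k (suc fuel) zero    = 0
lenAux k (suc fuel) (suc x) = suc (lenAux k fuel (suc x / (2 ℕ.+ k)))

len : ℕ → ℕ → ℕ
len k x = lenAux k x x

binLength : ℤ → ℕ
binLength x = len 0 ∣ x ∣

-- the L least significant base-(2+k) digits of x, least significant first
digits : (k : ℕ) → (L : ℕ) → ℕ → Vec (Fin (2 ℕ.+ k)) L
digits k zero    x = []
digits k (suc L) x = fromℕ< (m%n<n x (2 ℕ.+ k)) ∷ digits k L (x / (2 ℕ.+ k))

zipV : {A B : Set} {n : ℕ} → Vec A n → Vec B n → Vec (A × B) n
zipV [] [] = []
zipV (a ∷ as) (b ∷ bs) = (a , b) ∷ zipV as bs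

-- Automatic functions (on natural numbers), given by their graph G x y
-- ("y = f x"): bases i = 2+i', j = 2+j', a DFA with states Fin n, start q₀,
-- transition δ, accepting predicate acc, reading the convolution of the
-- base-i digits of x and the base-j digits of y padded with leading zeros
-- to the common length max(len x, len y).

AutomaticGraph : (ℕ → ℕ → Set) → Set
AutomaticGraph G =
  Σ ℕ λ i' → Σ ℕ λ j' → Σ ℕ λ n → Σ (Fin n) λ q₀ →
  Σ (Fin n → Fin (2 ℕ.+ i') → Fin (2 ℕ.+ j') → Fin n) λ δ →
  Σ (Fin n → Bool) λ acc →
  ∀ x y →
    let L = len i' x ⊔ len j' y
        w = zipV (digits i' L x) (digits j' L y)
        accepts = acc (foldl (λ _ → Fin n) (λ q ab → δ q (Data.Product.proj₁ ab) (Data.Product.proj₂ ab)) q₀ w) ≡ true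
    in (accepts → G x y) × (G x y → accepts)

IsF : (ℤ → ℤ) → ℤ → Set
IsF F x =
  (Σ ℕ λ k → 1 ≤ k × x ℤ.≤ + (2 ^ k) × F x ≡ + (2 ^ k) ℤ.* (x ℤ.⊔ + 1))
  × (∀ k → 1 ≤ k → x ℤ.≤ + (2 ^ k) → F x ℤ.≤ + (2 ^ k) ℤ.* (x ℤ.⊔ + 1))

-- Write X = max(x,1) and let J ≥ 1 be least with X ≤ 2^J, so that f(x) = 2^J·X.  The program
-- keeps r₀ = 2^j·X and r₁ = 2^j·(2^j − X); one round of additions takes j to j+1
-- (r₁ ↦ 2(2r₁ + r₀), r₀ ↦ 2r₀), and the loop stops as soon as r₁ ≥ 0, that is at j = J,
-- after fewer than log₂ x rounds.
--
-- If an automaton with n states recognised the graph of f, consider the n+1 inputs t + Pⱼ·Pᵢ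
-- (t ≤ n), where Pᵢ and Pⱼ are the n-th powers of the two bases.  Two of them, s < t, leave the
-- automaton in the same state after the n lowest digit pairs, and they agree above these digits.
-- Since f x + x′ ≤ f x′ for x < x′, the outputs f(s + Pⱼ·Pᵢ) and f(t + Pⱼ·Pᵢ) differ above
-- their n lowest digits; the low digits of the first output joined to the high digits of the
-- second then form a second number accepted as f of the first input.

{-# OPTIONS --safe #-}
module Submission where

open import Defs
open import Data.Nat as ℕ using (ℕ; zero; suc; _+_; _*_; _^_; _≤_; _<_; _⊔_; z≤n; s≤s; s≤s⁻¹)
open import Data.Nat.Properties
open import Data.Nat.DivMod
open import Data.Nat.Divisibility using (n∣m*n; ∣-refl)
import Data.Nat.Tactic.RingSolver as ℕ-Solver
open import Data.Integer as ℤ using (ℤ; +_; -[1+_]; +≤+; +<+)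
import Data.Integer.Properties as ℤP
open import Data.Integer.Tactic.RingSolver using (solve-∀)
open import Data.Fin as Fin using (Fin; toℕ)
open import Data.Fin.Properties using (fromℕ<-cong; pigeonhole; toℕ<n)
open import Data.Vec using (Vec; _∷_; foldl)
open import Data.List using ([]; _∷_)
open import Data.Maybe using (just; nothing)
open import Data.Product using (Σ; ∃-syntax; _×_; _,_; proj₁; proj₂)
open import Data.Sum using (inj₁; inj₂)
open import Data.Bool using (Bool; true; false)
open import Data.Empty using (⊥)
open import Relation.Nullary using (¬_; yes; no; contradiction)
open import Relation.Nullary.Decidable using (dec-true; dec-false)
open import Relation.Binary.PropositionalEquality
  using (_≡_; refl; sym; trans; cong; cong₂; subst; subst₂; module ≡-Reasoning)

n<[2+k]^n : ∀ k n → n < (2 + k) ^ n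
n<[2+k]^n k zero    = s≤s z≤n
n<[2+k]^n k (suc n) = ≤-<-trans (n<[2+k]^n k n) (^-monoʳ-< (2 + k) (s≤s (s≤s z≤n)) (n<1+n n))

record LeastExponent (X J : ℕ) : Set where
  field
    positive : 1 ≤ J
    fits     : X ≤ 2 ^ J
    minimal  : ∀ i → 1 ≤ i → i < J → 2 ^ i < X

LeastExponent-≤ : ∀ {X J k} → LeastExponent X J → 1 ≤ k → X ≤ 2 ^ k → J ≤ k
LeastExponent-≤ least 1≤k X≤2^k =
  ≮⇒≥ λ k<J → <⇒≱ (LeastExponent.minimal least _ 1≤k k<J) X≤2^k

leastExponent : ∀ X → ∃[ J ] LeastExponent X J
leastExponent X = search X 1 (s≤s z≤n) X≤2^[X+1] (λ i 1≤i i<1 → contradiction 1≤i (<⇒≱ i<1))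
  where
  X≤2^[X+1] : X ≤ 2 ^ (X + 1)
  X≤2^[X+1] = ≤-trans (<⇒≤ (n<[2+k]^n 0 X)) (^-monoʳ-≤ 2 (m≤m+n X 1))

  search : ∀ d j → 1 ≤ j → X ≤ 2 ^ (d + j) → (∀ i → 1 ≤ i → i < j → 2 ^ i < X) →
           ∃[ J ] LeastExponent X J
  search d j 1≤j fits below with X ≤? 2 ^ j
  ... | yes X≤2^j = j , record { positive = 1≤j ; fits = X≤2^j ; minimal = below }
  search zero    j 1≤j fits below | no X≰2^j = contradiction fits X≰2^j
  search (suc d) j 1≤j fits below | no X≰2^j =
    search d (suc j) (m≤n⇒m≤1+n 1≤j) (subst (λ e → X ≤ 2 ^ e) (sym (+-suc d j)) fits) below′
    where
    below′ : ∀ i → 1 ≤ i → i < suc j → 2 ^ i < X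
    below′ i 1≤i i<1+j with m≤n⇒m<n∨m≡n (s≤s⁻¹ i<1+j)
    ... | inj₁ i<j  = below i 1≤i i<j
    ... | inj₂ refl = ≰⇒> X≰2^j

exponent : ℕ → ℕ
exponent X = proj₁ (leastExponent X)

-- Agrees with the f of the theorem on positive inputs only (here f 0 = 0).
f : ℕ → ℕ
f x = 2 ^ exponent x * x

x≤f : ∀ x → x ≤ f x
x≤f x = m≤n*m x (2 ^ exponent x) {{m^n≢0 2 (exponent x)}}

f-gap : ∀ {x x′} → x < x′ → f x + x′ ≤ f x′
f-gap {x} {x′} x<x′ = begin
  2 ^ J * x + x′        ≤⟨ +-mono-≤ (*-monoˡ-≤ x (^-monoʳ-≤ 2 J≤J′)) fits′ ⟩
  2 ^ J′ * x + 2 ^ J′   ≡⟨ +-comm (2 ^ J′ * x) (2 ^ J′) ⟩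
  2 ^ J′ + 2 ^ J′ * x   ≡⟨ *-suc (2 ^ J′) x ⟨
  2 ^ J′ * suc x        ≤⟨ *-monoʳ-≤ (2 ^ J′) x<x′ ⟩
  2 ^ J′ * x′           ∎
  where
  open ≤-Reasoning
  J  = exponent x
  J′ = exponent x′
  least′ = proj₂ (leastExponent x′)
  fits′ = LeastExponent.fits least′
  J≤J′ : J ≤ J′
  J≤J′ = LeastExponent-≤ (proj₂ (leastExponent x)) (LeastExponent.positive least′)
           (≤-trans (<⇒≤ x<x′) fits′)

pow2 : ℕ → ℤ
pow2 j = + (2 ^ j)

F-value : ∀ {F x X J} → IsF F x → x ℤ.⊔ + 1 ≡ + X → LeastExponent X J → F x ≡ pow2 J ℤ.* + X
F-value {F} {x} {X} {J} ((k , 1≤k , x≤2^k , attained) , optimal) x⊔1≡X least =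
  ℤP.≤-antisym upper lower
  where
  open LeastExponent least
  open ≡-Reasoning
  X≤2^k : X ≤ 2 ^ k
  X≤2^k = ℤP.drop‿+≤+ (subst (ℤ._≤ pow2 k) x⊔1≡X (ℤP.⊔-lub x≤2^k (+≤+ (m^n>0 2 k))))
  upper : F x ℤ.≤ pow2 J ℤ.* + X
  upper = subst (λ m → F x ℤ.≤ pow2 J ℤ.* m) x⊔1≡X
    (optimal J positive (ℤP.≤-trans (ℤP.i≤i⊔j x (+ 1))
      (subst (ℤ._≤ pow2 J) (sym x⊔1≡X) (+≤+ fits))))
  lower : pow2 J ℤ.* + X ℤ.≤ F x
  lower = subst₂ ℤ._≤_ (ℤP.pos-* (2 ^ J) X)
    (begin
      + (2 ^ k * X)       ≡⟨ ℤP.pos-* (2 ^ k) X ⟩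
      pow2 k ℤ.* + X      ≡⟨ cong (pow2 k ℤ.*_) x⊔1≡X ⟨
      pow2 k ℤ.* (x ℤ.⊔ + 1) ≡⟨ attained ⟨
      F x                 ∎)
    (+≤+ (*-monoˡ-≤ X (^-monoʳ-≤ 2 (LeastExponent-≤ least 1≤k X≤2^k))))

F-on-positive : ∀ {F x} → IsF F (+ x) → 1 ≤ x → F (+ x) ≡ + f x
F-on-positive {F} {x} isF 1≤x =
  trans (F-value {F} isF (ℤP.i≥j⇒i⊔j≡i (+≤+ 1≤x)) (proj₂ (leastExponent x)))
        (sym (ℤP.pos-* (2 ^ exponent x) x))

dropDigits : ℕ → ℕ → ℕ → ℕ
dropDigits k m x = (x / (2 + k) ^ m) {{m^n≢0 (2 + k) m}}

takeDigits : ℕ → ℕ → ℕ → ℕ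
takeDigits k m x = (x % (2 + k) ^ m) {{m^n≢0 (2 + k) m}}

dropDigits-suc : ∀ k m x → dropDigits k m (x / (2 + k)) ≡ dropDigits k (suc m) x
dropDigits-suc k m x =
  m/n/o≡m/[n*o] x (2 + k) ((2 + k) ^ m) {{_}} {{m^n≢0 (2 + k) m}} {{m^n≢0 (2 + k) (suc m)}}

dropDigits-+-* : ∀ k m z q → z < (2 + k) ^ m → dropDigits k m (z + q * (2 + k) ^ m) ≡ q
dropDigits-+-* k m z q z<b^m = begin
  (z + q * b^m) / b^m       ≡⟨ +-distrib-/-∣ʳ z (n∣m*n q) ⟩
  z / b^m + q * b^m / b^m   ≡⟨ cong₂ _+_ (m<n⇒m/n≡0 z<b^m) (m*n/n≡m q b^m) ⟩
  q                         ∎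
  where
  open ≡-Reasoning
  b^m = (2 + k) ^ m
  instance _ = m^n≢0 (2 + k) m

dropDigits-< : ∀ k m {y y′} → y + (2 + k) ^ m ≤ y′ → dropDigits k m y < dropDigits k m y′
dropDigits-< k m {y} {y′} y+b^m≤y′ = begin-strict
  y / b^m                 <⟨ n<1+n (y / b^m) ⟩
  suc (y / b^m)           ≡⟨ +-comm 1 (y / b^m) ⟩
  y / b^m + 1             ≡⟨ cong (_+_ (y / b^m)) (n/n≡1 b^m) ⟨
  y / b^m + b^m / b^m     ≡⟨ +-distrib-/-∣ʳ y ∣-refl ⟨
  (y + b^m) / b^m         ≤⟨ /-monoˡ-≤ b^m y+b^m≤y′ ⟩
  y′ / b^m                ∎
  where
  open ≤-Reasoning
  b^m = (2 + k) ^ m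
  instance _ = m^n≢0 (2 + k) m

lenAux-fuel : ∀ k f g x → x ≤ f → x ≤ g → lenAux k f x ≡ lenAux k g x
lenAux-fuel k zero    zero    zero    _ _ = refl
lenAux-fuel k zero    (suc g) zero    _ _ = refl
lenAux-fuel k (suc f) zero    zero    _ _ = refl
lenAux-fuel k (suc f) (suc g) zero    _ _ = refl
lenAux-fuel k (suc f) (suc g) (suc x) (s≤s x≤f) (s≤s x≤g) =
  cong suc (lenAux-fuel k f g (suc x / (2 + k)) (≤-trans quotient≤x x≤f) (≤-trans quotient≤x x≤g))
  where
  quotient≤x : suc x / (2 + k) ≤ x
  quotient≤x = s≤s⁻¹ (m/n<m (suc x) (2 + k) (s≤s (s≤s z≤n)))

len-suc : ∀ k x → len k (suc x) ≡ suc (len k (suc x / (2 + k)))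
len-suc k x = cong suc (lenAux-fuel k x (suc x / (2 + k)) (suc x / (2 + k))
  (s≤s⁻¹ (m/n<m (suc x) (2 + k) (s≤s (s≤s z≤n)))) ≤-refl)

len-dropDigits : ∀ k m x → 1 ≤ dropDigits k m x → len k x ≡ m + len k (dropDigits k m x)
len-dropDigits k zero    x       _ = cong (len k) (sym (n/1≡n x))
len-dropDigits k (suc m) zero    1≤0 =
  contradiction (≤-reflexive (0/n≡0 ((2 + k) ^ suc m) {{m^n≢0 (2 + k) (suc m)}})) (<⇒≱ 1≤0)
len-dropDigits k (suc m) (suc x) 1≤high = begin
  len k (suc x)
    ≡⟨ len-suc k x ⟩
  suc (len k (suc x / (2 + k)))
    ≡⟨ cong suc (len-dropDigits k m (suc x / (2 + k)) 1≤high′) ⟩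
  suc (m + len k (dropDigits k m (suc x / (2 + k))))
    ≡⟨ cong (λ z → suc (m + len k z)) (dropDigits-suc k m (suc x)) ⟩
  suc (m + len k (dropDigits k (suc m) (suc x)))     ∎
  where
  open ≡-Reasoning
  1≤high′ : 1 ≤ dropDigits k m (suc x / (2 + k))
  1≤high′ = subst (1 ≤_) (sym (dropDigits-suc k m (suc x))) 1≤high

2^e≤x⇒e<len : ∀ e x → 2 ^ e ≤ x → e < len 0 x
2^e≤x⇒e<len e       zero    2^e≤0 = contradiction 2^e≤0 (<⇒≱ (m^n>0 2 e))
2^e≤x⇒e<len zero    (suc x) _     = subst (0 <_) (sym (len-suc 0 x)) (s≤s z≤n)
2^e≤x⇒e<len (suc e) (suc x) 2^[1+e]≤1+x =
  subst (suc e <_) (sym (len-suc 0 x)) (s≤s (2^e≤x⇒e<len e (suc x / 2) 2^e≤half))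
  where
  2^e≤half : 2 ^ e ≤ suc x / 2
  2^e≤half = subst (_≤ suc x / 2) (m*n/n≡m (2 ^ e) 2)
               (/-monoˡ-≤ 2 (subst (_≤ suc x) (*-comm 2 (2 ^ e)) 2^[1+e]≤1+x))

digits-+-* : ∀ k m z q → digits k m (z + q * (2 + k) ^ m) ≡ digits k m z
digits-+-* k zero    z q = refl
digits-+-* k (suc m) z q =
  cong₂ _∷_ (fromℕ<-cong _ _ lowest-digit _ _)
            (trans (cong (digits k m) higher-digits) (digits-+-* k m (z / b) q))
  where
  b = 2 + k
  regroup : z + q * b ^ suc m ≡ z + q * b ^ m * b
  regroup = cong (_+_ z) (trans (cong (q *_) (*-comm b (b ^ m))) (sym (*-assoc q (b ^ m) b)))
  lowest-digit : (z + q * b ^ suc m) % b ≡ z % b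
  lowest-digit = trans (cong (_% b) regroup) ([m+kn]%n≡m%n z (q * b ^ m) b)
  higher-digits : (z + q * b ^ suc m) / b ≡ z / b + q * b ^ m
  higher-digits = trans (cong (_/ b) regroup)
    (trans (+-distrib-/-∣ʳ z (n∣m*n (q * b ^ m))) (cong (_+_ (z / b)) (m*n/n≡m (q * b ^ m) b)))

digits-takeDigits : ∀ k m x → digits k m (takeDigits k m x) ≡ digits k m x
digits-takeDigits k m x = sym (begin
  digits k m x                          ≡⟨ cong (digits k m) (m≡m%n+[m/n]*n x b^m) ⟩
  digits k m (x % b^m + x / b^m * b^m)  ≡⟨ digits-+-* k m (x % b^m) (x / b^m) ⟩
  digits k m (x % b^m)                  ∎)
  where
  open ≡-Reasoning
  b^m = (2 + k) ^ m
  instance _ = m^n≢0 (2 + k) m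

run-+ : ∀ {r} (P : Program r) a {b c c₁ c₂} →
        run a P c ≡ just c₁ → run b P c₁ ≡ just c₂ → run (a + b) P c ≡ just c₂
run-+ P zero    refl h = h
run-+ P (suc a) {c = c} h₁ h₂ with step P c
run-+ P (suc a) {c = c} () h₂ | nothing
... | just c′ = run-+ P a h₁ h₂

r₀ r₁ : Fin 2
r₀ = Fin.zero
r₁ = Fin.suc Fin.zero

doubling : Program 2
doubling =
    read r₀                            --  0
  ∷ ifGoto ge r₀ (const (+ 1)) 3       --  1
  ∷ setC r₀ (+ 1)                      --  2
  ∷ addRR r₀ r₀ r₀                     --  3
  ∷ subCR r₁ (+ 4) r₀                  --  4
  ∷ ifGoto ge r₁ (const (+ 0)) 11      --  5
  ∷ addRR r₁ r₁ r₁                     --  6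
  ∷ addRR r₁ r₁ r₀                     --  7
  ∷ addRR r₁ r₁ r₁                     --  8
  ∷ addRR r₀ r₀ r₀                     --  9
  ∷ goto 5                             -- 10
  ∷ write r₀                           -- 11
  ∷ []

record LoopInv (X j : ℕ) (ρ : Fin 2 → ℤ) : Set where
  constructor loopInv
  field
    r₀-value : ρ r₀ ≡ pow2 j ℤ.* + X
    r₁-value : ρ r₁ ≡ pow2 j ℤ.* (pow2 j ℤ.- + X)

exit-test : ∀ {X j ρ} → LoopInv X j ρ → X ≤ 2 ^ j → evalRel ge (ρ r₁) (+ 0) ≡ true
exit-test {X} {j} (loopInv _ r₁≡) X≤2^j =
  trans (cong (λ v → evalRel ge v (+ 0)) r₁≡) (dec-true (+ 0 ℤ.≤? r₁-value) 0≤r₁)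
  where
  r₁-value = pow2 j ℤ.* (pow2 j ℤ.- + X)
  0≤r₁ : + 0 ℤ.≤ r₁-value
  0≤r₁ = subst (ℤ._≤ r₁-value) (ℤP.*-zeroʳ (pow2 j))
           (ℤP.*-monoˡ-≤-nonNeg (pow2 j) (ℤP.i≤j⇒0≤j-i (+≤+ X≤2^j)))

continue-test : ∀ {X j ρ} → LoopInv X j ρ → 2 ^ j < X → evalRel ge (ρ r₁) (+ 0) ≡ false
continue-test {X} {j} (loopInv _ r₁≡) 2^j<X =
  trans (cong (λ v → evalRel ge v (+ 0)) r₁≡) (dec-false (+ 0 ℤ.≤? r₁-value) r₁<0)
  where
  r₁-value = pow2 j ℤ.* (pow2 j ℤ.- + X)
  2^j-positive : ℤ.Positive (pow2 j)
  2^j-positive = ℤ.positive (+<+ (m^n>0 2 j))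
  r₁<0 : ¬ (+ 0 ℤ.≤ r₁-value)
  r₁<0 0≤r₁ = <⇒≱ 2^j<X (ℤP.drop‿+≤+ (ℤP.0≤i-j⇒j≤i
    (ℤP.*-cancelˡ-≤-pos (+ 0) (pow2 j ℤ.- + X) (pow2 j) {{2^j-positive}}
      (subst (ℤ._≤ r₁-value) (sym (ℤP.*-zeroʳ (pow2 j))) 0≤r₁))))

loop-exit : ∀ {X j ρ} → LoopInv X j ρ → X ≤ 2 ^ j →
            run 2 doubling (config 5 ρ [] []) ≡ just (config 12 ρ [] (pow2 j ℤ.* + X ∷ []))
loop-exit {X} {j} {ρ} inv@(loopInv r₀≡ _) X≤2^j
  with evalRel ge (ρ r₁) (+ 0) | exit-test inv X≤2^j
... | .true | refl = cong (λ v → just (config 12 ρ [] (v ∷ []))) r₀≡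

loop-body : ∀ {X j ρ} → LoopInv X j ρ → 2 ^ j < X →
            ∃[ ρ′ ] run 6 doubling (config 5 ρ [] []) ≡ just (config 5 ρ′ [] [])
                  × LoopInv X (suc j) ρ′
loop-body {X} {j} {ρ} inv@(loopInv r₀≡ r₁≡) 2^j<X
  with evalRel ge (ρ r₁) (+ 0) | continue-test inv 2^j<X
... | .false | refl = _ , refl , loopInv new-r₀ new-r₁
  where
  open ≡-Reasoning
  double-r₀ : ∀ a x → a ℤ.* x ℤ.+ a ℤ.* x ≡ (+ 2 ℤ.* a) ℤ.* x
  double-r₀ = solve-∀
  double-r₁ : ∀ a x → ((a ℤ.* (a ℤ.- x) ℤ.+ a ℤ.* (a ℤ.- x)) ℤ.+ a ℤ.* x)
                       ℤ.+ ((a ℤ.* (a ℤ.- x) ℤ.+ a ℤ.* (a ℤ.- x)) ℤ.+ a ℤ.* x)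
                     ≡ (+ 2 ℤ.* a) ℤ.* ((+ 2 ℤ.* a) ℤ.- x)
  double-r₁ = solve-∀
  2^[1+j] : pow2 (suc j) ≡ + 2 ℤ.* pow2 j
  2^[1+j] = ℤP.pos-* 2 (2 ^ j)
  new-r₀ : ρ r₀ ℤ.+ ρ r₀ ≡ pow2 (suc j) ℤ.* + X
  new-r₀ = begin
    ρ r₀ ℤ.+ ρ r₀                         ≡⟨ cong₂ ℤ._+_ r₀≡ r₀≡ ⟩
    pow2 j ℤ.* + X ℤ.+ pow2 j ℤ.* + X     ≡⟨ double-r₀ (pow2 j) (+ X) ⟩
    (+ 2 ℤ.* pow2 j) ℤ.* + X              ≡⟨ cong (ℤ._* + X) 2^[1+j] ⟨
    pow2 (suc j) ℤ.* + X                  ∎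
  new-r₁ : ((ρ r₁ ℤ.+ ρ r₁) ℤ.+ ρ r₀) ℤ.+ ((ρ r₁ ℤ.+ ρ r₁) ℤ.+ ρ r₀)
           ≡ pow2 (suc j) ℤ.* (pow2 (suc j) ℤ.- + X)
  new-r₁ = begin
    ((ρ r₁ ℤ.+ ρ r₁) ℤ.+ ρ r₀) ℤ.+ ((ρ r₁ ℤ.+ ρ r₁) ℤ.+ ρ r₀)
      ≡⟨ cong₂ (λ r s → ((r ℤ.+ r) ℤ.+ s) ℤ.+ ((r ℤ.+ r) ℤ.+ s)) r₁≡ r₀≡ ⟩
    _ ≡⟨ double-r₁ (pow2 j) (+ X) ⟩
    (+ 2 ℤ.* pow2 j) ℤ.* ((+ 2 ℤ.* pow2 j) ℤ.- + X)
      ≡⟨ cong (λ a → a ℤ.* (a ℤ.- + X)) 2^[1+j] ⟨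
    pow2 (suc j) ℤ.* (pow2 (suc j) ℤ.- + X) ∎

loop : ∀ {X J} → LeastExponent X J → ∀ e {j ρ} → 1 ≤ j → e + j ≡ J → LoopInv X j ρ →
       ∃[ ρ′ ] run (e * 6 + 2) doubling (config 5 ρ [] [])
                 ≡ just (config 12 ρ′ [] (pow2 J ℤ.* + X ∷ []))
loop least zero    1≤j refl inv = _ , loop-exit inv (LeastExponent.fits least)
loop least (suc e) {j} {ρ} 1≤j e+j≡J inv =
  let ρ′ , body , inv′ = loop-body inv (LeastExponent.minimal least j 1≤j j<J)
      ρ″ , rest        = loop least e (m≤n⇒m≤1+n 1≤j) (trans (+-suc e j) e+j≡J) inv′
  in ρ″ , run-+ doubling 6 {c = config 5 ρ [] []} {c₁ = config 5 ρ′ [] []} body rest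
  where
  j<J : j < _
  j<J = subst (j <_) e+j≡J (s≤s (m≤n+m j e))

max1 : ℤ → ℕ
max1 (+ zero)  = 1
max1 (+ suc n) = suc n
max1 -[1+ n ]  = 1

max1-≡ : ∀ x → x ℤ.⊔ + 1 ≡ + max1 x
max1-≡ (+ zero)  = refl
max1-≡ (+ suc n) = ℤP.i≥j⇒i⊔j≡i (+≤+ (s≤s z≤n))
max1-≡ -[1+ n ]  = refl

prelude : ∀ x → ∃[ s ] s ≤ 5 × ∃[ ρ ] run s doubling (initConfig 2 x) ≡ just (config 5 ρ [] [])
                                     × LoopInv (max1 x) 1 ρ
prelude (+ zero)  = 5 , ≤-refl , _ , refl , loopInv refl refl
prelude (+ suc n) =
  4 , n≤1+n 4 , _ , refl , loopInv (double (+ suc n)) (four-minus-double (+ suc n))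
  where
  double : ∀ a → a ℤ.+ a ≡ + 2 ℤ.* a
  double = solve-∀
  four-minus-double : ∀ a → + 4 ℤ.- (a ℤ.+ a) ≡ + 2 ℤ.* (+ 2 ℤ.- a)
  four-minus-double = solve-∀
prelude -[1+ n ]  = 5 , ≤-refl , _ , refl , loopInv refl refl

loopCount≤binLength : ∀ x {e} → LeastExponent (max1 x) (suc e) → e ≤ binLength x
loopCount≤binLength x         {zero}  _     = z≤n
loopCount≤binLength (+ suc n) {suc e} least =
  <⇒≤ (2^e≤x⇒e<len (suc e) (suc n) (<⇒≤ (LeastExponent.minimal least (suc e) (s≤s z≤n) ≤-refl)))
loopCount≤binLength (+ zero)  {suc e} least =
  contradiction (m^n>0 2 (suc e)) (<⇒≱ (LeastExponent.minimal least (suc e) (s≤s z≤n) ≤-refl))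
loopCount≤binLength -[1+ n ]  {suc e} least =
  contradiction (m^n>0 2 (suc e)) (<⇒≱ (LeastExponent.minimal least (suc e) (s≤s z≤n) ≤-refl))

steps≤ : ∀ {s e B} → s ≤ 5 → e ≤ B → s + (e * 6 + 2) ≤ 7 * (B + 1)
steps≤ {s} {e} {B} s≤5 e≤B = begin
  s + (e * 6 + 2)        ≤⟨ +-mono-≤ s≤5 (+-monoˡ-≤ 2 (*-monoˡ-≤ 6 e≤B)) ⟩
  5 + (B * 6 + 2)        ≤⟨ m≤m+n (5 + (B * 6 + 2)) B ⟩
  5 + (B * 6 + 2) + B    ≡⟨ regroup B ⟩
  7 * (B + 1)            ∎
  where
  open ≤-Reasoning
  regroup : ∀ B → 5 + (B * 6 + 2) + B ≡ 7 * (B + 1)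
  regroup = ℕ-Solver.solve-∀

doubling-computes : ∀ {F} → (∀ x → IsF F x) →
                    ComputesInTime doubling F (λ x → 7 * (binLength x + 1))
doubling-computes {F} isF x with leastExponent (max1 x) | prelude x
... | zero  , least | _ = contradiction (LeastExponent.positive least) λ ()
... | suc e , least | s , s≤5 , ρ , enter , inv =
  let ρ′ , iterate = loop least e (s≤s z≤n) (+-comm e 1) inv in
  s + (e * 6 + 2) , steps≤ s≤5 (loopCount≤binLength x least) , _ ,
  run-+ doubling s enter iterate , ≤-refl ,
  cong (_∷ []) (sym (F-value {F} (isF x) (max1-≡ x) least))

module DFA {i′ j′ n : ℕ} (δ : Fin n → Fin (2 + i′) → Fin (2 + j′) → Fin n) where

  Word : ∀ L → ℕ → ℕ → Vec (Fin (2 + i′) × Fin (2 + j′)) L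
  Word L x y = zipV (digits i′ L x) (digits j′ L y)

  runFrom : ∀ {L} → Fin n → Vec (Fin (2 + i′) × Fin (2 + j′)) L → Fin n
  runFrom q w = foldl (λ _ → Fin n) (λ q ab → δ q (proj₁ ab) (proj₂ ab)) q w

  runFrom-+ : ∀ m r x y q → runFrom q (Word (m + r) x y) ≡
              runFrom (runFrom q (Word m x y)) (Word r (dropDigits i′ m x) (dropDigits j′ m y))
  runFrom-+ zero    r x y q =
    cong₂ (λ x′ y′ → runFrom q (Word r x′ y′)) (sym (n/1≡n x)) (sym (n/1≡n y))
  runFrom-+ (suc m) r x y q = begin
    runFrom q (Word (suc m + r) x y)
      ≡⟨ runFrom-+ m r (x / (2 + i′)) (y / (2 + j′)) _ ⟩
    runFrom (runFrom q (Word (suc m) x y))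
            (Word r (dropDigits i′ m (x / (2 + i′))) (dropDigits j′ m (y / (2 + j′))))
      ≡⟨ cong₂ (λ x′ y′ → runFrom (runFrom q (Word (suc m) x y)) (Word r x′ y′))
               (dropDigits-suc i′ m x) (dropDigits-suc j′ m y) ⟩
    runFrom (runFrom q (Word (suc m) x y))
            (Word r (dropDigits i′ (suc m) x) (dropDigits j′ (suc m) y)) ∎
    where open ≡-Reasoning

  runPair : Fin n → ℕ → ℕ → Fin n
  runPair q x y = runFrom q (Word (len i′ x ⊔ len j′ y) x y)

  runPair-split : ∀ m {x y} q → 1 ≤ dropDigits i′ m x → 1 ≤ dropDigits j′ m y →
                  runPair q x y
                    ≡ runPair (runFrom q (Word m x y)) (dropDigits i′ m x) (dropDigits j′ m y)
  runPair-split m {x} {y} q 1≤x 1≤y = begin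
    runFrom q (Word (len i′ x ⊔ len j′ y) x y)
      ≡⟨ cong (λ L → runFrom q (Word L x y)) length-split ⟩
    runFrom q (Word (m + r) x y)
      ≡⟨ runFrom-+ m r x y q ⟩
    runPair (runFrom q (Word m x y)) (dropDigits i′ m x) (dropDigits j′ m y) ∎
    where
    open ≡-Reasoning
    r = len i′ (dropDigits i′ m x) ⊔ len j′ (dropDigits j′ m y)
    length-split : len i′ x ⊔ len j′ y ≡ m + r
    length-split = trans (cong₂ _⊔_ (len-dropDigits i′ m x 1≤x) (len-dropDigits j′ m y 1≤y))
                         (sym (+-distribˡ-⊔ m _ _))

  runPair-splice : ∀ m {x y x′ y′} q → runFrom q (Word m x y) ≡ runFrom q (Word m x′ y′) →
                   dropDigits i′ m x ≡ dropDigits i′ m x′ → dropDigits j′ m y ≡ dropDigits j′ m y′ →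
                   1 ≤ dropDigits i′ m x → 1 ≤ dropDigits j′ m y → runPair q x y ≡ runPair q x′ y′
  runPair-splice m {x} {y} {x′} {y′} q same-state same-x same-y 1≤x 1≤y = begin
    runPair q x y
      ≡⟨ runPair-split m q 1≤x 1≤y ⟩
    runPair (runFrom q (Word m x y)) (dropDigits i′ m x) (dropDigits j′ m y)
      ≡⟨ cong (λ q′ → runPair q′ (dropDigits i′ m x) (dropDigits j′ m y)) same-state ⟩
    runPair (runFrom q (Word m x′ y′)) (dropDigits i′ m x) (dropDigits j′ m y)
      ≡⟨ cong₂ (runPair (runFrom q (Word m x′ y′))) same-x same-y ⟩
    runPair (runFrom q (Word m x′ y′)) (dropDigits i′ m x′) (dropDigits j′ m y′)
      ≡⟨ runPair-split m q (subst (1 ≤_) same-x 1≤x) (subst (1 ≤_) same-y 1≤y) ⟨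
    runPair q x′ y′ ∎
    where open ≡-Reasoning

module Forgery {F : ℤ → ℤ} (isF : ∀ x → IsF F x)
               {i′ j′ n : ℕ} (q₀ : Fin n) (δ : Fin n → Fin (2 + i′) → Fin (2 + j′) → Fin n)
               (acc : Fin n → Bool)
               (decides : ∀ x y → (acc (DFA.runPair δ q₀ x y) ≡ true → F (+ x) ≡ + y)
                                × (F (+ x) ≡ + y → acc (DFA.runPair δ q₀ x y) ≡ true)) where
  open DFA δ

  Pᵢ Pⱼ : ℕ
  Pᵢ = (2 + i′) ^ n
  Pⱼ = (2 + j′) ^ n

  -- The high part Pⱼ makes every output at least Pⱼ, so that its high part is nonzero as well.
  input : Fin (suc n) → ℕ
  input t = toℕ t + Pⱼ * Pᵢ

  output : Fin (suc n) → ℕ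
  output t = f (input t)

  state : Fin (suc n) → Fin n
  state t = runFrom q₀ (Word n (input t) (output t))

  input-high : ∀ t → dropDigits i′ n (input t) ≡ Pⱼ
  input-high t = dropDigits-+-* i′ n (toℕ t) Pⱼ (<-≤-trans (toℕ<n t) (n<[2+k]^n i′ n))

  Pⱼ≤input : ∀ t → Pⱼ ≤ input t
  Pⱼ≤input t = ≤-trans (m≤m*n Pⱼ Pᵢ {{m^n≢0 (2 + i′) n}}) (m≤n+m (Pⱼ * Pᵢ) (toℕ t))

  Pⱼ≤output : ∀ t → Pⱼ ≤ output t
  Pⱼ≤output t = ≤-trans (Pⱼ≤input t) (x≤f (input t))

  F-input : ∀ t → F (+ input t) ≡ + output t
  F-input t = F-on-positive {F} (isF _) (≤-trans (m^n>0 (2 + j′) n) (Pⱼ≤input t))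

  no-collision : ∀ {s t} → toℕ s < toℕ t → state s ≡ state t → ⊥
  no-collision {s} {t} s<t same =
    <⇒≢ high-grows (trans (cong (dropDigits j′ n) output-is-forged) forged-high)
    where
    forged : ℕ
    forged = takeDigits j′ n (output s) + dropDigits j′ n (output t) * Pⱼ

    forged-low : digits j′ n forged ≡ digits j′ n (output s)
    forged-low = trans (digits-+-* j′ n _ (dropDigits j′ n (output t)))
                       (digits-takeDigits j′ n (output s))

    forged-high : dropDigits j′ n forged ≡ dropDigits j′ n (output t)
    forged-high = dropDigits-+-* j′ n _ _ (m%n<n (output s) Pⱼ {{m^n≢0 (2 + j′) n}})

    same-state : runFrom q₀ (Word n (input t) (output t)) ≡ runFrom q₀ (Word n (input s) forged)
    same-state = trans (sym same)
      (cong (λ ds → runFrom q₀ (zipV (digits i′ n (input s)) ds)) (sym forged-low))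

    forged-accepted : acc (runPair q₀ (input s) forged) ≡ true
    forged-accepted = subst (λ q → acc q ≡ true)
      (runPair-splice n q₀ same-state (trans (input-high t) (sym (input-high s))) (sym forged-high)
        (subst (1 ≤_) (sym (input-high t)) (m^n>0 (2 + j′) n))
        (m≥n⇒m/n>0 {{m^n≢0 (2 + j′) n}} (Pⱼ≤output t)))
      (proj₂ (decides _ _) (F-input t))

    output-is-forged : output s ≡ forged
    output-is-forged =
      ℤP.+-injective (trans (sym (F-input s)) (proj₁ (decides _ _) forged-accepted))

    high-grows : dropDigits j′ n (output s) < dropDigits j′ n (output t)
    high-grows = dropDigits-< j′ n
      (≤-trans (+-monoʳ-≤ (output s) (Pⱼ≤input t)) (f-gap (+-monoˡ-< (Pⱼ * Pᵢ) s<t)))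

notAutomatic : ∀ {F} → (∀ x → IsF F x) → ¬ AutomaticGraph (λ x y → F (+ x) ≡ + y)
notAutomatic isF (i′ , j′ , n , q₀ , δ , acc , decides) =
  let s , t , s<t , same = pigeonhole (n<1+n n) state in no-collision s<t same
  where open Forgery isF q₀ δ acc decides

mainTheorem10 : (F : ℤ → ℤ) → (∀ x → IsF F x) →
    (Σ (Program 2) λ P → Σ ℕ λ c → ComputesInTime P F (λ x → c * (binLength x + 1)))
    × ¬ AutomaticGraph (λ x y → F (+ x) ≡ + y)
mainTheorem10 F isF = (doubling , 7 , doubling-computes isF) , notAutomatic isF
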